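{- Let $D$ be a tournament, $T\subseteq V(D)$, $\sigma=(v_1,\dots,v_n)$ an order of $V(D)$, and $I=[v_l,v_r]$ a maximal non-terminal interval w.r.t. $\sigma$; let $I_L=[v_1,v_{l-1}]$ and $I_R=[v_{r+1},v_n]$ (possibly empty). Then for every unaffected vertex $v\in I$, every vertex of $I_L$ is an in-neighbour of $v$ and every vertex of $I_R$ is an out-neighbour of $v$.
   Context: The interval $[v_a,v_b]=\{v_m:a\le m\le b\}$; a non-terminal interval contains no vertex of $T$; it is maximal if it is not a proper subinterval of another non-terminal interval. An arc $v_av_b$ is backward if $b<a$; its span is $[v_b,v_a]$ and it is above each vertex of its span. A backward arc above at least one terminal is affected; a vertex is affected if it is an endpoint of an affected arc, and unaffected otherwise. -}

module Defs where

open import Data.Nat using (ℕ)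
open import Data.Fin using (Fin; _≤_; _<_)
open import Data.Fin.Permutation using (Permutation′; _⟨$⟩ʳ_)
open import Data.Product using (Σ; _×_; ∃)
open import Data.Sum using (_⊎_)
open import Relation.Nullary using (¬_)
open import Relation.Binary.PropositionalEquality using (_≡_; _≢_)
open import Level using (0ℓ; suc)

record Tournament (n : ℕ) : Set₁ where
  field
    Arc      : Fin n → Fin n → Set
    loopless : ∀ u → ¬ Arc u u
    total    : ∀ u v → u ≢ v → Arc u v ⊎ Arc v u
    asym     : ∀ u v → Arc u v → ¬ Arc v u

-- An order σ = (v_0, …, v_{n-1}) of V(D) (positions 0-indexed): σ ⟨$⟩ʳ m is v_m.
Order : ℕ → Set
Order n = Permutation′ n

module _ {n : ℕ} (D : Tournament n) (T : Fin n → Set) (σ : Order n) where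
  open Tournament D

  vx : Fin n → Fin n
  vx m = σ ⟨$⟩ʳ m

  InInterval : Fin n → Fin n → Fin n → Set
  InInterval a b m = a ≤ m × m ≤ b

  NonTerminal : Fin n → Fin n → Set
  NonTerminal a b = ∀ m → InInterval a b m → ¬ T (vx m)

  MaximalNonTerminal : Fin n → Fin n → Set
  MaximalNonTerminal l r =
    l ≤ r × NonTerminal l r ×
    (∀ a b → a ≤ b → NonTerminal a b → a ≤ l → r ≤ b → a ≡ l × b ≡ r)

  Backward : Fin n → Fin n → Set
  Backward a b = Arc (vx a) (vx b) × b < a

  AffectedArc : Fin n → Fin n → Set
  AffectedArc a b = Backward a b × Σ (Fin n) (λ m → InInterval b a m × T (vx m))

  Affected : Fin n → Set
  Affected k = Σ (Fin n) (λ a → Σ (Fin n) (λ b →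
                 AffectedArc a b × (a ≡ k ⊎ b ≡ k)))

  Unaffected : Fin n → Set
  Unaffected k = ¬ Affected k

-- An arc between an unaffected vertex v_k of I and a vertex v_m outside I that
-- pointed the "wrong" way would be a backward arc with a terminal-free span
-- (otherwise it would be affected, and so would v_k).  That span overlaps I,
-- so together with I it forms a strictly larger non-terminal interval,
-- contradicting maximality; by totality the arc points the right way.
module Submission where

open import Defs
open import Data.Nat using (ℕ)
open import Data.Fin using (Fin; toℕ; _≤_; _<_; _≤?_)
open import Data.Fin.Properties using (<⇒≢)
open import Data.Nat.Properties using (≤-refl; <⇒≤; <-≤-trans; ≤-<-trans; ≰⇒>; <-irrefl)
open import Data.Empty using (⊥-elim)
open import Data.Product using (_×_; _,_; proj₁; proj₂)
open import Data.Sum using (_⊎_; inj₁; inj₂)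
open import Function.Bundles using (Injection)
open import Function.Definitions using (Injective)
open import Function.Properties.Inverse using (↔⇒↣)
open import Relation.Nullary using (¬_; yes; no)
open import Relation.Binary.PropositionalEquality using (_≡_; _≢_; refl; sym; cong)

module _ {n : ℕ} (D : Tournament n) (T : Fin n → Set) (σ : Order n) where
  open Tournament D

  vx-injective : Injective _≡_ _≡_ (vx D T σ)
  vx-injective = Injection.injective (↔⇒↣ σ)

  arc-either-way : ∀ {a b} → a ≢ b →
    Arc (vx D T σ a) (vx D T σ b) ⊎ Arc (vx D T σ b) (vx D T σ a)
  arc-either-way a≢b = total _ _ (λ e → a≢b (vx-injective e))

  nonTerminal-overlap : ∀ {a b c d} → b ≤ c →
    NonTerminal D T σ a c → NonTerminal D T σ b d → NonTerminal D T σ a d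
  nonTerminal-overlap {c = c} b≤c ntᵃᶜ ntᵇᵈ j (a≤j , j≤d) with j ≤? c
  ... | yes j≤c = ntᵃᶜ j (a≤j , j≤c)
  ... | no  j≰c = ntᵇᵈ j (<⇒≤ (≤-<-trans b≤c (≰⇒> j≰c)) , j≤d)

  backward-span-nonTerminal : ∀ {k a b} → Unaffected D T σ k →
    Backward D T σ a b → a ≡ k ⊎ b ≡ k → NonTerminal D T σ b a
  backward-span-nonTerminal unaffected back endpoint j j∈span tⱼ =
    unaffected (_ , _ , (back , j , j∈span , tⱼ) , endpoint)

  module _ {l r : Fin n} (maximal : MaximalNonTerminal D T σ l r) where
    private
      l≤r = proj₁ maximal
      nonTerminal = proj₁ (proj₂ maximal)
      extremal = proj₂ (proj₂ maximal)

    maximal-not-extendableˡ : ∀ {m} → m < l → ¬ NonTerminal D T σ m r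
    maximal-not-extendableˡ m<l ntᵐʳ =
      <-irrefl (cong toℕ m≡l) m<l
      where
      m≡l = proj₁ (extremal _ _ (<⇒≤ (<-≤-trans m<l l≤r)) ntᵐʳ (<⇒≤ m<l) ≤-refl)

    maximal-not-extendableʳ : ∀ {m} → r < m → ¬ NonTerminal D T σ l m
    maximal-not-extendableʳ r<m ntˡᵐ =
      <-irrefl (cong toℕ (sym m≡r)) r<m
      where
      m≡r = proj₂ (extremal _ _ (<⇒≤ (≤-<-trans l≤r r<m)) ntˡᵐ ≤-refl (<⇒≤ r<m))

    unaffected-arc-fromˡ : ∀ {k m} → InInterval D T σ l r k → Unaffected D T σ k →
      m < l → Arc (vx D T σ m) (vx D T σ k)
    unaffected-arc-fromˡ (l≤k , _) unaffected m<l
      with arc-either-way (<⇒≢ (<-≤-trans m<l l≤k))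
    ... | inj₁ m→k = m→k
    ... | inj₂ k→m = ⊥-elim (maximal-not-extendableˡ m<l (nonTerminal-overlap l≤k span nonTerminal))
      where
      span = backward-span-nonTerminal unaffected (k→m , <-≤-trans m<l l≤k) (inj₁ refl)

    unaffected-arc-toʳ : ∀ {k m} → InInterval D T σ l r k → Unaffected D T σ k →
      r < m → Arc (vx D T σ k) (vx D T σ m)
    unaffected-arc-toʳ (_ , k≤r) unaffected r<m
      with arc-either-way (<⇒≢ (≤-<-trans k≤r r<m))
    ... | inj₁ k→m = k→m
    ... | inj₂ m→k = ⊥-elim (maximal-not-extendableʳ r<m (nonTerminal-overlap k≤r nonTerminal span))
      where
      span = backward-span-nonTerminal unaffected (m→k , ≤-<-trans k≤r r<m) (inj₂ refl)

lemma6 : ∀ {n : ℕ} (D : Tournament n) (T : Fin n → Set) (σ : Order n)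
    (l r : Fin n) → MaximalNonTerminal D T σ l r →
    ∀ (k : Fin n) → InInterval D T σ l r k → Unaffected D T σ k →
    (∀ (m : Fin n) → m < l → Tournament.Arc D (vx D T σ m) (vx D T σ k)) ×
    (∀ (m : Fin n) → r < m → Tournament.Arc D (vx D T σ k) (vx D T σ m))
lemma6 D T σ l r maximal k k∈I unaffected =
    (λ m → unaffected-arc-fromˡ D T σ maximal k∈I unaffected)
  , (λ m → unaffected-arc-toʳ D T σ maximal k∈I unaffected)
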